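{- Let $d,k\ge 1$ be integers and let $K=\partial(\Delta_{d+1})*\cdots*\partial(\Delta_{d+1})$ be the $(k+1)$-fold join of copies of the boundary of a $d$-dimensional simplex, with vertex set $V(K)$ (so $|V(K)|=(d+1)(k+1)$). Let $K^{(d)}$ be the $d$-skeleton of $K$. Then $K^{(d)}$ is $d$-lumpless, i.e. for every subset $\emptyset\neq S\subsetneq V(K)$, $$\frac{f_0(K^{(d)}[S])}{f_d(K^{(d)}[S])}>\frac{f_0(K^{(d)})}{f_d(K^{(d)})}.$$
   Context: $\Delta_{d+1}$ denotes the $d$-dimensional simplex (on $d+1$ vertices) and $\partial(\Delta_{d+1})$ its boundary complex. The join $\Delta_0*\Delta_1$ of complexes on disjoint vertex sets has faces $\sigma\cup\tau$ with $\sigma\in\Delta_0$, $\tau\in\Delta_1$. $f_i(\Delta)$ is the number of $i$-dimensional faces of $\Delta$; for $S\subseteq V$, $\Delta[S]$ is the induced subcomplex consisting of faces contained in $S$; $\Delta^{(d)}$ is the $d$-skeleton. A ratio with denominator $0$ is interpreted as $+\infty$. -}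

module Defs where

open import Data.Nat using (ℕ; zero; suc; _+_; _*_; _<_; _≤ᵇ_)
open import Data.Bool using (Bool; true; false; _∧_; _∨_; not; if_then_else_)
open import Data.Vec using (Vec; []; _∷_; take; drop)
open import Data.List using (List; []; _∷_; map; _++_; length; filterᵇ)
open import Data.Fin.Subset using (Subset; ∣_∣; inside; outside)
open import Data.Empty using (⊥)
open import Data.Unit using (⊤)

-- A simplicial complex on vertex set Fin n, given by its (decidable)
-- face predicate on subsets of the vertex set.
Complex : ℕ → Set
Complex n = Subset n → Bool

allSubsets : (n : ℕ) → List (Subset n)
allSubsets zero = [] ∷ []
allSubsets (suc n) = map (outside ∷_) (allSubsets n) ++ map (inside ∷_) (allSubsets n)

_⊆ᵇ_ : ∀ {n} → Subset n → Subset n → Bool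
[] ⊆ᵇ [] = true
(x ∷ xs) ⊆ᵇ (y ∷ ys) = (not x ∨ y) ∧ (xs ⊆ᵇ ys)

isFull : ∀ {n} → Subset n → Bool
isFull [] = true
isFull (x ∷ xs) = x ∧ isFull xs

-- boundary of the simplex on n vertices: all proper subsets of Fin n
-- (for n = d+1 this is ∂(Δ_{d+1}), the boundary of the d-dimensional simplex)
boundarySimplex : (n : ℕ) → Complex n
boundarySimplex n σ = not (isFull σ)

-- join of complexes on disjoint vertex sets Fin m and Fin n
-- (vertices of the join: Fin (m + n), first m from the first complex)
join : ∀ {m n} → Complex m → Complex n → Complex (m + n)
join {m} A B σ = A (take m σ) ∧ B (drop m σ)

-- the complex {∅} on no vertices (unit for the join)
unitComplex : Complex 0
unitComplex _ = true

joinPow : ∀ {n} (k : ℕ) → Complex n → Complex (suc k * n)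
joinPow zero Δ = join Δ unitComplex
joinPow (suc k) Δ = join Δ (joinPow k Δ)

skeleton : ∀ {n} → ℕ → Complex n → Complex n
skeleton d Δ σ = Δ σ ∧ (∣ σ ∣ ≤ᵇ suc d)

induced : ∀ {n} → Complex n → Subset n → Complex n
induced Δ S σ = Δ σ ∧ (σ ⊆ᵇ S)

-- f_i(Δ): number of i-dimensional faces (faces with i+1 vertices)
f : ∀ {n} → ℕ → Complex n → ℕ
f {n} i Δ = length (filterᵇ (λ σ → Δ σ ∧ (∣ σ ∣ ≤ᵇ suc i) ∧ (suc i ≤ᵇ ∣ σ ∣)) (allSubsets n))

-- a / b > c / e, with a ratio whose denominator is 0 read as +∞
_/_>_/_ : ℕ → ℕ → ℕ → ℕ → Set
a / zero > c / zero = ⊥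
a / zero > c / suc e = ⊤
a / suc b > c / zero = ⊥
a / suc b > c / suc e = c * suc b < a * suc e

{-# OPTIONS --safe #-}
-- Vertices are faces, and the only (d+1)-element non-faces of the join are its k + 1 blocks,
-- so f₀(K[S]) = |S| and f_d(K[S]) = C(|S|, d+1) − β_S, where β_S counts the blocks inside S,
-- while f_d(K) = C(n, d+1) − (k+1) with n = (k+1)(d+1). Multiplying by d+1 and using
-- (d+1)·C(m, d+1) = m·C(m−1, d), the claim n·f_d(K[S]) < |S|·f_d(K) reduces to
-- C(|S|−1, d) < C(n−1, d) − 1 when β_S = 0, resp. C(|S|−1, d) ≤ C(n−1, d) − 1 otherwise.
-- Both follow from strict growth of C(−, d): if S contains no block it misses a vertex of
-- every block, so |S| ≤ n − 2.
module Submission where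

open import Defs
open import Algebra.Properties.CommutativeSemigroup using (interchange)
open import Data.Bool.Base using (Bool; true; false; T; _∧_; _∨_; not)
open import Data.Bool.Properties using (not-injective; ∧-zeroʳ; ∧-identityʳ; ∧-assoc; T-∧; T-∨; T-not-≡; T-≡)
open import Data.Empty using (⊥-elim)
open import Data.Fin.Subset using (Subset; Nonempty; ⊤; ∣_∣; inside; outside; ⁅_⁆; _⊆_; _∈_)
open import Data.Fin.Subset.Properties using (∣⊤∣≡n; ∣p∣≤n; ∣p∣≡n⇒p≡⊤; ∣⁅x⁆∣≡1; p⊆q⇒∣p∣≤∣q∣; x∈⁅y⁆⇒x≡y)
open import Data.List.Base using (List; []; _∷_; _++_; map; filterᵇ; length)
open import Data.List.Properties using (length-++; filter-++)
open import Data.Nat.Base using (ℕ; zero; suc; _+_; _*_; _≤_; _<_; _≤ᵇ_; _≡ᵇ_; z≤n; s≤s)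
open import Data.Nat.Combinatorics using (_C_; nC1≡n; nCn≡1; nCk+nC[k+1]≡[n+1]C[k+1])
open import Data.Nat.Properties
open import Data.Nat.Tactic.RingSolver using (solve-∀)
open import Data.Product using (_×_; _,_)
open import Data.Sum using (_⊎_; inj₁; inj₂; map₂)
open import Data.Vec.Base using ([]; _∷_; take; drop)
open import Function using (_∘_; _⇔_; Equivalence)
open import Relation.Binary.PropositionalEquality
  using (_≡_; _≢_; refl; sym; trans; cong; cong₂; subst; subst₂; module ≡-Reasoning)
open import Relation.Nullary.Decidable.Core using (yes; no; T?)

open Equivalence using (to; from)

-- `f i Δ` unfolds to `count` of its defining predicate.
count : ∀ {n} → (Subset n → Bool) → ℕ
count {n} P = length (filterᵇ P (allSubsets n))

length-filterᵇ-map : ∀ {A B : Set} (P : B → Bool) (h : A → B) (xs : List A) →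
  length (filterᵇ P (map h xs)) ≡ length (filterᵇ (P ∘ h) xs)
length-filterᵇ-map P h [] = refl
length-filterᵇ-map P h (x ∷ xs) with P (h x)
... | true = cong suc (length-filterᵇ-map P h xs)
... | false = length-filterᵇ-map P h xs

count-suc : ∀ {n} (P : Subset (suc n) → Bool) →
  count P ≡ count (P ∘ (outside ∷_)) + count (P ∘ (inside ∷_))
count-suc {n} P = begin
  length (filterᵇ P (map (outside ∷_) σs ++ map (inside ∷_) σs))
    ≡⟨ cong length (filter-++ (T? ∘ P) (map (outside ∷_) σs) _) ⟩
  length (filterᵇ P (map (outside ∷_) σs) ++ filterᵇ P (map (inside ∷_) σs))
    ≡⟨ length-++ (filterᵇ P (map (outside ∷_) σs)) ⟩
  length (filterᵇ P (map (outside ∷_) σs)) + length (filterᵇ P (map (inside ∷_) σs))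
    ≡⟨ cong₂ _+_ (length-filterᵇ-map P _ σs) (length-filterᵇ-map P _ σs) ⟩
  count (P ∘ (outside ∷_)) + count (P ∘ (inside ∷_)) ∎
  where
  open ≡-Reasoning
  σs = allSubsets n

count-false : ∀ n → count {n} (λ _ → false) ≡ 0
count-false zero = refl
count-false (suc n) = trans (count-suc {n} (λ _ → false)) (cong₂ _+_ (count-false n) (count-false n))

count-mono : ∀ {n} {P Q : Subset n → Bool} → (∀ σ → T (P σ) → T (Q σ)) → count P ≤ count Q
count-mono {zero} {P} {Q} P⇒Q with P [] | Q [] | P⇒Q []
... | false | _ | _ = z≤n
... | true | true | _ = ≤-refl
... | true | false | p⇒q = ⊥-elim (p⇒q _)
count-mono {suc n} {P} {Q} P⇒Q = begin
  count P                                             ≡⟨ count-suc P ⟩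
  count (P ∘ (outside ∷_)) + count (P ∘ (inside ∷_))
    ≤⟨ +-mono-≤ (count-mono (P⇒Q ∘ (outside ∷_))) (count-mono (P⇒Q ∘ (inside ∷_))) ⟩
  count (Q ∘ (outside ∷_)) + count (Q ∘ (inside ∷_))  ≡⟨ count-suc Q ⟨
  count Q                                             ∎
  where open ≤-Reasoning

count-cong : ∀ {n} {P Q : Subset n → Bool} → (∀ σ → P σ ≡ Q σ) → count P ≡ count Q
count-cong P≡Q =
  ≤-antisym (count-mono (λ σ → subst T (P≡Q σ))) (count-mono (λ σ → subst T (sym (P≡Q σ))))

count-∨ : ∀ {n} (P Q : Subset n → Bool) → count (λ σ → P σ ∨ Q σ) ≤ count P + count Q
count-∨ {zero} P Q with P [] | Q []
... | false | false = z≤n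
... | false | true = ≤-refl
... | true | _ = s≤s z≤n
count-∨ {suc n} P Q = begin
  count (λ σ → P σ ∨ Q σ)                               ≡⟨ count-suc (λ σ → P σ ∨ Q σ) ⟩
  count (λ σ → Pₒ σ ∨ Qₒ σ) + count (λ σ → Pᵢ σ ∨ Qᵢ σ) ≤⟨ +-mono-≤ (count-∨ Pₒ Qₒ) (count-∨ Pᵢ Qᵢ) ⟩
  (count Pₒ + count Qₒ) + (count Pᵢ + count Qᵢ)
    ≡⟨ interchange +-commutativeSemigroup (count Pₒ) (count Qₒ) (count Pᵢ) (count Qᵢ) ⟩
  (count Pₒ + count Pᵢ) + (count Qₒ + count Qᵢ)         ≡⟨ cong₂ _+_ (count-suc P) (count-suc Q) ⟨
  count P + count Q                                     ∎
  where
  open ≤-Reasoning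
  Pₒ Pᵢ Qₒ Qᵢ : Subset n → Bool
  Pₒ = P ∘ (outside ∷_)
  Pᵢ = P ∘ (inside ∷_)
  Qₒ = Q ∘ (outside ∷_)
  Qᵢ = Q ∘ (inside ∷_)

count-partition : ∀ {n} (P Q : Subset n → Bool) →
  count (λ σ → P σ ∧ Q σ) + count (λ σ → not (P σ) ∧ Q σ) ≡ count Q
count-partition {zero} P Q with P [] | Q []
... | false | true = refl
... | false | false = refl
... | true | true = refl
... | true | false = refl
count-partition {suc n} P Q = begin
  count (λ σ → P σ ∧ Q σ) + count (λ σ → not (P σ) ∧ Q σ)
    ≡⟨ cong₂ _+_ (count-suc (λ σ → P σ ∧ Q σ)) (count-suc (λ σ → not (P σ) ∧ Q σ)) ⟩
  (count Yₒ + count Yᵢ) + (count Nₒ + count Nᵢ)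
    ≡⟨ interchange +-commutativeSemigroup (count Yₒ) (count Yᵢ) (count Nₒ) (count Nᵢ) ⟩
  (count Yₒ + count Nₒ) + (count Yᵢ + count Nᵢ)
    ≡⟨ cong₂ _+_ (count-partition (P ∘ (outside ∷_)) (Q ∘ (outside ∷_)))
                 (count-partition (P ∘ (inside ∷_)) (Q ∘ (inside ∷_))) ⟩
  count (Q ∘ (outside ∷_)) + count (Q ∘ (inside ∷_))
    ≡⟨ count-suc Q ⟨
  count Q ∎
  where
  open ≡-Reasoning
  Yₒ Yᵢ Nₒ Nᵢ : Subset n → Bool
  Yₒ σ = P (outside ∷ σ) ∧ Q (outside ∷ σ)
  Yᵢ σ = P (inside ∷ σ) ∧ Q (inside ∷ σ)
  Nₒ σ = not (P (outside ∷ σ)) ∧ Q (outside ∷ σ)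
  Nᵢ σ = not (P (inside ∷ σ)) ∧ Q (inside ∷ σ)

count-witness : ∀ {n} (P : Subset n → Bool) σ → T (P σ) → 1 ≤ count P
count-witness {zero} P [] Pσ with P []
... | true = ≤-refl
count-witness {suc n} P (x ∷ σ) Pσ = ≤-trans (witness x Pσ) (≤-reflexive (sym (count-suc P)))
  where
  witness : ∀ x → T (P (x ∷ σ)) → 1 ≤ count (P ∘ (outside ∷_)) + count (P ∘ (inside ∷_))
  witness false Pσ = ≤-trans (count-witness _ σ Pσ) (m≤m+n _ _)
  witness true Pσ = ≤-trans (count-witness _ σ Pσ) (m≤n+m _ _)

count-split : ∀ m {n} (P : Subset m → Bool) (Q : Subset n → Bool) →
  count (λ σ → P (take m σ) ∧ Q (drop m σ)) ≡ count P * count Q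
count-split zero {n} P Q with P []
... | true = sym (+-identityʳ (count Q))
... | false = count-false n
count-split (suc m) P Q = begin
  count (λ σ → P (take (suc m) σ) ∧ Q (drop (suc m) σ))
    ≡⟨ count-suc (λ σ → P (take (suc m) σ) ∧ Q (drop (suc m) σ)) ⟩
  count (λ σ → P (outside ∷ take m σ) ∧ Q (drop m σ)) + count (λ σ → P (inside ∷ take m σ) ∧ Q (drop m σ))
    ≡⟨ cong₂ _+_ (count-split m (P ∘ (outside ∷_)) Q) (count-split m (P ∘ (inside ∷_)) Q) ⟩
  count (P ∘ (outside ∷_)) * count Q + count (P ∘ (inside ∷_)) * count Q
    ≡⟨ *-distribʳ-+ (count Q) (count (P ∘ (outside ∷_))) _ ⟨
  (count (P ∘ (outside ∷_)) + count (P ∘ (inside ∷_))) * count Q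
    ≡⟨ cong (_* count Q) (count-suc P) ⟨
  count P * count Q ∎
  where open ≡-Reasoning

∣take∣+∣drop∣≡∣σ∣ : ∀ m {n} (σ : Subset (m + n)) → ∣ take m σ ∣ + ∣ drop m σ ∣ ≡ ∣ σ ∣
∣take∣+∣drop∣≡∣σ∣ zero σ = refl
∣take∣+∣drop∣≡∣σ∣ (suc m) (outside ∷ σ) = ∣take∣+∣drop∣≡∣σ∣ m σ
∣take∣+∣drop∣≡∣σ∣ (suc m) (inside ∷ σ) = cong suc (∣take∣+∣drop∣≡∣σ∣ m σ)

⊆ᵇ-split : ∀ m {n} (σ S : Subset (m + n)) →
  (σ ⊆ᵇ S) ≡ (take m σ ⊆ᵇ take m S) ∧ (drop m σ ⊆ᵇ drop m S)
⊆ᵇ-split zero σ S = refl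
⊆ᵇ-split (suc m) (x ∷ σ) (y ∷ S) rewrite ∧-assoc (not x ∨ y) (take m σ ⊆ᵇ take m S) (drop m σ ⊆ᵇ drop m S) =
  cong ((not x ∨ y) ∧_) (⊆ᵇ-split m σ S)

T-⊆ᵇ-split : ∀ m {n} {σ S : Subset (m + n)} →
  T (σ ⊆ᵇ S) ⇔ (T (take m σ ⊆ᵇ take m S) × T (drop m σ ⊆ᵇ drop m S))
T-⊆ᵇ-split m {σ = σ} {S} rewrite ⊆ᵇ-split m σ S = T-∧

⊆ᵇ⊤ : ∀ {n} (σ : Subset n) → T (σ ⊆ᵇ ⊤)
⊆ᵇ⊤ [] = _
⊆ᵇ⊤ (outside ∷ σ) = ⊆ᵇ⊤ σ
⊆ᵇ⊤ (inside ∷ σ) = ⊆ᵇ⊤ σ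

sizedSubsetᵇ : ∀ {n} → Subset n → ℕ → Subset n → Bool
sizedSubsetᵇ S t σ = (σ ⊆ᵇ S) ∧ (∣ σ ∣ ≡ᵇ t)

sizedSubsetᵇ⁻ : ∀ {n} {S σ : Subset n} {t} → T (sizedSubsetᵇ S t σ) → T (σ ⊆ᵇ S) × ∣ σ ∣ ≡ t
sizedSubsetᵇ⁻ {σ = σ} {t} h with to T-∧ h
... | σ⊆S , ∣σ∣≡t = σ⊆S , ≡ᵇ⇒≡ ∣ σ ∣ t ∣σ∣≡t

sizedSubsetᵇ⁺ : ∀ {n} {S σ : Subset n} {t} → T (σ ⊆ᵇ S) → ∣ σ ∣ ≡ t → T (sizedSubsetᵇ S t σ)
sizedSubsetᵇ⁺ {σ = σ} {t} σ⊆S ∣σ∣≡t = from T-∧ (σ⊆S , ≡⇒≡ᵇ ∣ σ ∣ t ∣σ∣≡t)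

count-sizedSubset : ∀ {n} (S : Subset n) t → count (sizedSubsetᵇ S t) ≡ ∣ S ∣ C t
count-sizedSubset [] zero = refl
count-sizedSubset [] (suc t) = refl
count-sizedSubset {suc n} (outside ∷ S) t = begin
  count (sizedSubsetᵇ (outside ∷ S) t)                ≡⟨ count-suc (sizedSubsetᵇ (outside ∷ S) t) ⟩
  count (sizedSubsetᵇ S t) + count {n} (λ _ → false)  ≡⟨ cong₂ _+_ (count-sizedSubset S t) (count-false n) ⟩
  ∣ S ∣ C t + 0                                        ≡⟨ +-identityʳ _ ⟩
  ∣ S ∣ C t                                            ∎
  where open ≡-Reasoning
count-sizedSubset {suc n} (inside ∷ S) zero = begin
  count (sizedSubsetᵇ (inside ∷ S) 0)
    ≡⟨ count-suc (sizedSubsetᵇ (inside ∷ S) 0) ⟩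
  count (sizedSubsetᵇ S 0) + count (λ σ → (σ ⊆ᵇ S) ∧ false)
    ≡⟨ cong₂ _+_ (count-sizedSubset S 0) (trans (count-cong (λ σ → ∧-zeroʳ (σ ⊆ᵇ S))) (count-false n)) ⟩
  1 + 0 ∎
  where open ≡-Reasoning
count-sizedSubset {suc n} (inside ∷ S) (suc t) = begin
  count (sizedSubsetᵇ (inside ∷ S) (suc t))
    ≡⟨ count-suc (sizedSubsetᵇ (inside ∷ S) (suc t)) ⟩
  count (sizedSubsetᵇ S (suc t)) + count (sizedSubsetᵇ S t)
    ≡⟨ cong₂ _+_ (count-sizedSubset S (suc t)) (count-sizedSubset S t) ⟩
  ∣ S ∣ C suc t + ∣ S ∣ C t                            ≡⟨ +-comm (∣ S ∣ C suc t) _ ⟩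
  ∣ S ∣ C t + ∣ S ∣ C suc t                            ≡⟨ nCk+nC[k+1]≡[n+1]C[k+1] ∣ S ∣ t ⟩
  suc ∣ S ∣ C suc t                                    ∎
  where open ≡-Reasoning

suc≤ᵇsuc : ∀ s t → (suc s ≤ᵇ suc t) ≡ (s ≤ᵇ t)
suc≤ᵇsuc zero t = refl
suc≤ᵇsuc (suc s) t = refl

≤ᵇ∧≥ᵇ≡≡ᵇ : ∀ s t → (s ≤ᵇ t) ∧ (t ≤ᵇ s) ≡ (s ≡ᵇ t)
≤ᵇ∧≥ᵇ≡≡ᵇ zero zero = refl
≤ᵇ∧≥ᵇ≡≡ᵇ zero (suc t) = refl
≤ᵇ∧≥ᵇ≡≡ᵇ (suc s) zero = refl
≤ᵇ∧≥ᵇ≡≡ᵇ (suc s) (suc t) rewrite suc≤ᵇsuc s t | suc≤ᵇsuc t s = ≤ᵇ∧≥ᵇ≡≡ᵇ s t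

exact-size-below : ∀ (j u : Bool) {s t D} → t ≤ D →
  ((j ∧ (s ≤ᵇ D)) ∧ u) ∧ (s ≤ᵇ t) ∧ (t ≤ᵇ s) ≡ j ∧ u ∧ (s ≡ᵇ t)
exact-size-below j u {s} {t} {D} t≤D rewrite ≤ᵇ∧≥ᵇ≡≡ᵇ s t with s ≡ᵇ t in s≡ᵇt
... | false rewrite ∧-zeroʳ ((j ∧ (s ≤ᵇ D)) ∧ u) | ∧-zeroʳ u = sym (∧-zeroʳ j)
... | true rewrite ≡ᵇ⇒≡ s t (from T-≡ s≡ᵇt) | to T-≡ (≤⇒≤ᵇ t≤D)
                 | ∧-identityʳ j | ∧-identityʳ (j ∧ u) | ∧-identityʳ u = refl

nonfaceᵇ : ∀ {n} → ℕ → Complex n → Subset n → Subset n → Bool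
nonfaceᵇ t J S σ = not (J σ) ∧ sizedSubsetᵇ S t σ

nonfaces : ∀ {n} → ℕ → Complex n → Subset n → ℕ
nonfaces t J S = count (nonfaceᵇ t J S)

nonfaceᵇ⁻ : ∀ {n t} {J : Complex n} {S σ} → T (nonfaceᵇ t J S σ) → J σ ≡ false × T (σ ⊆ᵇ S) × ∣ σ ∣ ≡ t
nonfaceᵇ⁻ {S = S} {σ} h with to T-∧ h
... | ¬Jσ , σ∈S = to T-not-≡ ¬Jσ , sizedSubsetᵇ⁻ {S = S} {σ} σ∈S

nonfaceᵇ⁺ : ∀ {n t} {J : Complex n} {S σ} → J σ ≡ false → T (σ ⊆ᵇ S) → ∣ σ ∣ ≡ t → T (nonfaceᵇ t J S σ)
nonfaceᵇ⁺ {S = S} {σ} ¬Jσ σ⊆S ∣σ∣≡t = from T-∧ (from T-not-≡ ¬Jσ , sizedSubsetᵇ⁺ {S = S} {σ} σ⊆S ∣σ∣≡t)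

NonfaceSize≥ : ∀ {n} → ℕ → Complex n → Set
NonfaceSize≥ m J = ∀ σ → J σ ≡ false → m ≤ ∣ σ ∣

nonfaces-below : ∀ {n m t} {J : Complex n} → NonfaceSize≥ m J → t < m → (S : Subset n) → nonfaces t J S ≡ 0
nonfaces-below {n} {m} {t} {J} J≥m t<m S =
  n≤0⇒n≡0 (≤-trans (count-mono small-nonface) (≤-reflexive (count-false n)))
  where
  small-nonface : ∀ σ → T (nonfaceᵇ t J S σ) → T false
  small-nonface σ h with nonfaceᵇ⁻ {J = J} {S} {σ} h
  ... | ¬Jσ , _ , ∣σ∣≡t = <⇒≱ t<m (subst (m ≤_) ∣σ∣≡t (J≥m σ ¬Jσ))

f-skeleton-induced : ∀ {n} d i (J : Complex n) (S : Subset n) → i ≤ d →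
  f i (induced (skeleton d J) S) + nonfaces (suc i) J S ≡ ∣ S ∣ C suc i
f-skeleton-induced d i J S i≤d = begin
  f i (induced (skeleton d J) S) + nonfaces (suc i) J S
    ≡⟨ cong (_+ nonfaces (suc i) J S) (count-cong (λ σ → exact-size-below (J σ) (σ ⊆ᵇ S) {∣ σ ∣} (s≤s i≤d))) ⟩
  count (λ σ → J σ ∧ sizedSubsetᵇ S (suc i) σ) + nonfaces (suc i) J S
    ≡⟨ count-partition J (sizedSubsetᵇ S (suc i)) ⟩
  count (sizedSubsetᵇ S (suc i))
    ≡⟨ count-sizedSubset S (suc i) ⟩
  ∣ S ∣ C suc i ∎
  where open ≡-Reasoning

f-induced-⊤ : ∀ {n} i (Δ : Complex n) → f i (induced Δ ⊤) ≡ f i Δ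
f-induced-⊤ i Δ = count-cong (λ σ → cong (_∧ _) (induced-⊤ σ))
  where
  induced-⊤ : ∀ σ → induced Δ ⊤ σ ≡ Δ σ
  induced-⊤ σ rewrite to T-≡ (⊆ᵇ⊤ σ) = ∧-identityʳ (Δ σ)

f-skeleton : ∀ {n} d i (J : Complex n) → i ≤ d → f i (skeleton d J) + nonfaces (suc i) J ⊤ ≡ n C suc i
f-skeleton {n} d i J i≤d = begin
  f i (skeleton d J) + nonfaces (suc i) J ⊤
    ≡⟨ cong (_+ nonfaces (suc i) J ⊤) (f-induced-⊤ i (skeleton d J)) ⟨
  f i (induced (skeleton d J) ⊤) + nonfaces (suc i) J ⊤  ≡⟨ f-skeleton-induced d i J ⊤ i≤d ⟩
  ∣ ⊤ {n} ∣ C suc i                                       ≡⟨ cong (_C suc i) (∣⊤∣≡n n) ⟩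
  n C suc i                                              ∎
  where open ≡-Reasoning

m+n≡o≤m⇒m≡o×n≡0 : ∀ {m n o} → m + n ≡ o → o ≤ m → m ≡ o × n ≡ 0
m+n≡o≤m⇒m≡o×n≡0 {m} {n} m+n≡o o≤m =
  m≡o , +-cancelˡ-≡ m n 0 (trans m+n≡o (trans (sym m≡o) (sym (+-identityʳ m))))
  where
  m≡o = ≤-antisym (subst (m ≤_) m+n≡o (m≤m+n m n)) o≤m

∧≡false : ∀ x {y} → x ∧ y ≡ false → x ≡ false ⊎ y ≡ false
∧≡false false _ = inj₁ refl
∧≡false true y≡false = inj₂ y≡false

NonfaceSize≥-join : ∀ {m n t} {A : Complex m} {B : Complex n} →
  NonfaceSize≥ t A → NonfaceSize≥ t B → NonfaceSize≥ t (join A B)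
NonfaceSize≥-join {m} {A = A} A≥t B≥t σ ¬ABσ with ∧≡false (A (take m σ)) ¬ABσ
... | inj₁ ¬Aσₗ = ≤-trans (A≥t _ ¬Aσₗ) (≤-trans (m≤m+n _ _) (≤-reflexive (∣take∣+∣drop∣≡∣σ∣ m σ)))
... | inj₂ ¬Bσᵣ = ≤-trans (B≥t _ ¬Bσᵣ) (≤-trans (m≤n+m _ _) (≤-reflexive (∣take∣+∣drop∣≡∣σ∣ m σ)))

module _ {m n t : ℕ} (A : Complex m) (B : Complex n) (S : Subset (m + n)) where

  private
    Sₗ = take m S
    Sᵣ = drop m S

  join-nonfaceᵇ : ∀ σ → A (take m σ) ∧ B (drop m σ) ≡ false →
    T (take m σ ⊆ᵇ Sₗ) → T (drop m σ ⊆ᵇ Sᵣ) → ∣ take m σ ∣ + ∣ drop m σ ∣ ≡ t →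
    T (nonfaceᵇ t (join A B) S σ)
  join-nonfaceᵇ σ ¬ABσ σₗ⊆Sₗ σᵣ⊆Sᵣ ∣σₗ∣+∣σᵣ∣≡t = nonfaceᵇ⁺ {J = join A B} {S} {σ} ¬ABσ
    (from (T-⊆ᵇ-split m) (σₗ⊆Sₗ , σᵣ⊆Sᵣ)) (trans (sym (∣take∣+∣drop∣≡∣σ∣ m σ)) ∣σₗ∣+∣σᵣ∣≡t)

  nonfaces-join-≥ˡ : nonfaces t A Sₗ ≤ nonfaces t (join A B) S
  nonfaces-join-≥ˡ = begin
    nonfaces t A Sₗ                                   ≡⟨ *-identityʳ _ ⟨
    nonfaces t A Sₗ * 1                               ≡⟨ cong (nonfaces t A Sₗ *_) (count-sizedSubset Sᵣ 0) ⟨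
    nonfaces t A Sₗ * count (sizedSubsetᵇ Sᵣ 0)       ≡⟨ count-split m (nonfaceᵇ t A Sₗ) (sizedSubsetᵇ Sᵣ 0) ⟨
    count (λ σ → nonfaceᵇ t A Sₗ (take m σ) ∧ sizedSubsetᵇ Sᵣ 0 (drop m σ)) ≤⟨ count-mono embed ⟩
    nonfaces t (join A B) S                           ∎
    where
    open ≤-Reasoning
    embed : ∀ σ → T (nonfaceᵇ t A Sₗ (take m σ) ∧ sizedSubsetᵇ Sᵣ 0 (drop m σ)) → T (nonfaceᵇ t (join A B) S σ)
    embed σ h with to T-∧ h
    ... | hₗ , hᵣ with nonfaceᵇ⁻ {J = A} {Sₗ} {take m σ} hₗ | sizedSubsetᵇ⁻ {S = Sᵣ} {drop m σ} hᵣ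
    ... | ¬Aσₗ , σₗ⊆Sₗ , ∣σₗ∣≡t | σᵣ⊆Sᵣ , ∣σᵣ∣≡0 = join-nonfaceᵇ σ (cong (_∧ B (drop m σ)) ¬Aσₗ) σₗ⊆Sₗ σᵣ⊆Sᵣ
      (trans (cong₂ _+_ ∣σₗ∣≡t ∣σᵣ∣≡0) (+-identityʳ t))

  nonfaces-join-≥ʳ : nonfaces t B Sᵣ ≤ nonfaces t (join A B) S
  nonfaces-join-≥ʳ = begin
    nonfaces t B Sᵣ                                   ≡⟨ *-identityˡ _ ⟨
    1 * nonfaces t B Sᵣ                               ≡⟨ cong (_* nonfaces t B Sᵣ) (count-sizedSubset Sₗ 0) ⟨
    count (sizedSubsetᵇ Sₗ 0) * nonfaces t B Sᵣ       ≡⟨ count-split m (sizedSubsetᵇ Sₗ 0) (nonfaceᵇ t B Sᵣ) ⟨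
    count (λ σ → sizedSubsetᵇ Sₗ 0 (take m σ) ∧ nonfaceᵇ t B Sᵣ (drop m σ)) ≤⟨ count-mono embed ⟩
    nonfaces t (join A B) S                           ∎
    where
    open ≤-Reasoning
    embed : ∀ σ → T (sizedSubsetᵇ Sₗ 0 (take m σ) ∧ nonfaceᵇ t B Sᵣ (drop m σ)) → T (nonfaceᵇ t (join A B) S σ)
    embed σ h with to T-∧ h
    ... | hₗ , hᵣ with sizedSubsetᵇ⁻ {S = Sₗ} {take m σ} hₗ | nonfaceᵇ⁻ {J = B} {Sᵣ} {drop m σ} hᵣ
    ... | σₗ⊆Sₗ , ∣σₗ∣≡0 | ¬Bσᵣ , σᵣ⊆Sᵣ , ∣σᵣ∣≡t = join-nonfaceᵇ σ
      (trans (cong (A (take m σ) ∧_) ¬Bσᵣ) (∧-zeroʳ _)) σₗ⊆Sₗ σᵣ⊆Sᵣ (cong₂ _+_ ∣σₗ∣≡0 ∣σᵣ∣≡t)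

  nonfaces-join-≤ : NonfaceSize≥ t A → NonfaceSize≥ t B →
    nonfaces t (join A B) S ≤ nonfaces t A Sₗ + nonfaces t B Sᵣ
  nonfaces-join-≤ A≥t B≥t = begin
    nonfaces t (join A B) S
      ≤⟨ count-mono nonface-on-one-side ⟩
    count (λ σ → L σ ∨ R σ)
      ≤⟨ count-∨ L R ⟩
    count L + count R
      ≡⟨ cong₂ _+_ (count-split m (nonfaceᵇ t A Sₗ) (sizedSubsetᵇ Sᵣ 0))
                 (count-split m (sizedSubsetᵇ Sₗ 0) (nonfaceᵇ t B Sᵣ)) ⟩
    nonfaces t A Sₗ * count (sizedSubsetᵇ Sᵣ 0) + count (sizedSubsetᵇ Sₗ 0) * nonfaces t B Sᵣ
      ≡⟨ cong₂ (λ x y → nonfaces t A Sₗ * x + y * nonfaces t B Sᵣ)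
               (count-sizedSubset Sᵣ 0) (count-sizedSubset Sₗ 0) ⟩
    nonfaces t A Sₗ * 1 + 1 * nonfaces t B Sᵣ
      ≡⟨ cong₂ _+_ (*-identityʳ (nonfaces t A Sₗ)) (*-identityˡ (nonfaces t B Sᵣ)) ⟩
    nonfaces t A Sₗ + nonfaces t B Sᵣ ∎
    where
    open ≤-Reasoning
    L R : Subset (m + n) → Bool
    L σ = nonfaceᵇ t A Sₗ (take m σ) ∧ sizedSubsetᵇ Sᵣ 0 (drop m σ)
    R σ = sizedSubsetᵇ Sₗ 0 (take m σ) ∧ nonfaceᵇ t B Sᵣ (drop m σ)
    nonface-on-one-side : ∀ σ → T (nonfaceᵇ t (join A B) S σ) → T (L σ ∨ R σ)
    nonface-on-one-side σ h with nonfaceᵇ⁻ {J = join A B} {S} {σ} h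
    ... | ¬ABσ , σ⊆S , ∣σ∣≡t with to (T-⊆ᵇ-split m) σ⊆S | ∧≡false (A (take m σ)) ¬ABσ
    ... | σₗ⊆Sₗ , σᵣ⊆Sᵣ | inj₁ ¬Aσₗ with m+n≡o≤m⇒m≡o×n≡0 (trans (∣take∣+∣drop∣≡∣σ∣ m σ) ∣σ∣≡t) (A≥t _ ¬Aσₗ)
    ...   | ∣σₗ∣≡t , ∣σᵣ∣≡0 = from T-∨ (inj₁ (from T-∧
            (nonfaceᵇ⁺ {J = A} {Sₗ} {take m σ} ¬Aσₗ σₗ⊆Sₗ ∣σₗ∣≡t , sizedSubsetᵇ⁺ {S = Sᵣ} {drop m σ} σᵣ⊆Sᵣ ∣σᵣ∣≡0)))
    nonface-on-one-side σ h
      | ¬ABσ , σ⊆S , ∣σ∣≡t | σₗ⊆Sₗ , σᵣ⊆Sᵣ | inj₂ ¬Bσᵣ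
      with m+n≡o≤m⇒m≡o×n≡0 (trans (+-comm ∣ drop m σ ∣ _) (trans (∣take∣+∣drop∣≡∣σ∣ m σ) ∣σ∣≡t)) (B≥t _ ¬Bσᵣ)
    ...   | ∣σᵣ∣≡t , ∣σₗ∣≡0 = from T-∨ (inj₂ (from T-∧
            (sizedSubsetᵇ⁺ {S = Sₗ} {take m σ} σₗ⊆Sₗ ∣σₗ∣≡0 , nonfaceᵇ⁺ {J = B} {Sᵣ} {drop m σ} ¬Bσᵣ σᵣ⊆Sᵣ ∣σᵣ∣≡t)))

isFull⇒∣σ∣≡n : ∀ {n} (σ : Subset n) → isFull σ ≡ true → ∣ σ ∣ ≡ n
isFull⇒∣σ∣≡n [] _ = refl
isFull⇒∣σ∣≡n (inside ∷ σ) σ-full = cong suc (isFull⇒∣σ∣≡n σ σ-full)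

isFull-⊤ : ∀ n → isFull (⊤ {n}) ≡ true
isFull-⊤ zero = refl
isFull-⊤ (suc n) = isFull-⊤ n

module _ (n : ℕ) where

  private
    ∂Δ = boundarySimplex n

  NonfaceSize≥-∂Δ : NonfaceSize≥ n ∂Δ
  NonfaceSize≥-∂Δ σ ¬∂Δσ = ≤-reflexive (sym (isFull⇒∣σ∣≡n σ (not-injective ¬∂Δσ)))

  1≤nonfaces-∂Δ-⊤ : 1 ≤ nonfaces n ∂Δ ⊤
  1≤nonfaces-∂Δ-⊤ = count-witness (nonfaceᵇ n ∂Δ ⊤) ⊤
    (nonfaceᵇ⁺ {J = ∂Δ} {⊤} {⊤} (cong not (isFull-⊤ n)) (⊆ᵇ⊤ (⊤ {n})) (∣⊤∣≡n n))

  nonfaces-∂Δ≤1 : ∀ S → nonfaces n ∂Δ S ≤ 1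
  nonfaces-∂Δ≤1 S = begin
    nonfaces n ∂Δ S           ≤⟨ count-mono full-sized ⟩
    count (sizedSubsetᵇ (⊤ {n}) n) ≡⟨ count-sizedSubset (⊤ {n}) n ⟩
    ∣ ⊤ {n} ∣ C n              ≡⟨ cong (_C n) (∣⊤∣≡n n) ⟩
    n C n                     ≡⟨ nCn≡1 n ⟩
    1                         ∎
    where
    open ≤-Reasoning
    full-sized : ∀ σ → T (nonfaceᵇ n ∂Δ S σ) → T (sizedSubsetᵇ (⊤ {n}) n σ)
    full-sized σ h with nonfaceᵇ⁻ {J = ∂Δ} {S} {σ} h
    ... | _ , _ , ∣σ∣≡n = sizedSubsetᵇ⁺ {S = ⊤} {σ} (⊆ᵇ⊤ σ) ∣σ∣≡n

  NonfaceSize≥-joinPow : ∀ k → NonfaceSize≥ n (joinPow k ∂Δ)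
  NonfaceSize≥-joinPow zero = NonfaceSize≥-join NonfaceSize≥-∂Δ (λ _ ())
  NonfaceSize≥-joinPow (suc k) = NonfaceSize≥-join NonfaceSize≥-∂Δ (NonfaceSize≥-joinPow k)

  nonfaces-joinPow≤ : ∀ k S → nonfaces n (joinPow k ∂Δ) S ≤ suc k
  nonfaces-joinPow≤ zero S =
    ≤-trans (nonfaces-join-≤ ∂Δ unitComplex S NonfaceSize≥-∂Δ (λ _ ()))
      (+-mono-≤ (nonfaces-∂Δ≤1 _)
        (≤-reflexive (nonfaces-below {m = suc n} {J = unitComplex} (λ _ ()) ≤-refl (drop n S))))
  nonfaces-joinPow≤ (suc k) S =
    ≤-trans (nonfaces-join-≤ ∂Δ (joinPow k ∂Δ) S NonfaceSize≥-∂Δ (NonfaceSize≥-joinPow k))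
      (+-mono-≤ (nonfaces-∂Δ≤1 _) (nonfaces-joinPow≤ k _))

  nonface-or-deficient-∂Δ-join : ∀ {b c} (B : Complex b) →
    (∀ S → 1 ≤ nonfaces n B S ⊎ ∣ S ∣ + c ≤ b) →
    (∀ S → 1 ≤ nonfaces n (join ∂Δ B) S ⊎ ∣ S ∣ + suc c ≤ n + b)
  nonface-or-deficient-∂Δ-join {b} {c} B nonface-or-deficient-B S
    with ∣ take n S ∣ ≟ n | nonface-or-deficient-B (drop n S)
  ... | yes ∣Sₗ∣≡n | _ = inj₁ (≤-trans
        (subst (λ Sₗ → 1 ≤ nonfaces n ∂Δ Sₗ) (sym (∣p∣≡n⇒p≡⊤ ∣Sₗ∣≡n)) 1≤nonfaces-∂Δ-⊤)
        (nonfaces-join-≥ˡ ∂Δ B S))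
  ... | no _ | inj₁ 1≤nonfaces-B = inj₁ (≤-trans 1≤nonfaces-B (nonfaces-join-≥ʳ ∂Δ B S))
  ... | no ∣Sₗ∣≢n | inj₂ ∣Sᵣ∣+c≤b = inj₂ (begin
        ∣ S ∣ + suc c                     ≡⟨ cong (_+ suc c) (∣take∣+∣drop∣≡∣σ∣ n S) ⟨
        (∣ Sₗ ∣ + ∣ Sᵣ ∣) + suc c           ≡⟨ +-assoc ∣ Sₗ ∣ ∣ Sᵣ ∣ (suc c) ⟩
        ∣ Sₗ ∣ + (∣ Sᵣ ∣ + suc c)           ≡⟨ cong (∣ Sₗ ∣ +_) (+-suc ∣ Sᵣ ∣ c) ⟩
        ∣ Sₗ ∣ + suc (∣ Sᵣ ∣ + c)           ≡⟨ +-suc ∣ Sₗ ∣ (∣ Sᵣ ∣ + c) ⟩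
        suc ∣ Sₗ ∣ + (∣ Sᵣ ∣ + c)           ≤⟨ +-mono-≤ (≤∧≢⇒< (∣p∣≤n Sₗ) ∣Sₗ∣≢n) ∣Sᵣ∣+c≤b ⟩
        n + b                             ∎)
    where
    open ≤-Reasoning
    Sₗ = take n S
    Sᵣ = drop n S

  -- Either S contains a block, or it misses a vertex of each of the k + 1 blocks.
  nonface-or-deficient : ∀ k (S : Subset (suc k * n)) →
    1 ≤ nonfaces n (joinPow k ∂Δ) S ⊎ ∣ S ∣ + suc k ≤ suc k * n
  nonface-or-deficient zero = nonface-or-deficient-∂Δ-join unitComplex (λ { [] → inj₂ z≤n })
  nonface-or-deficient (suc k) = nonface-or-deficient-∂Δ-join (joinPow k ∂Δ) (nonface-or-deficient k)

[1+k]*[1+n]C[1+k]≡[1+n]*nCk : ∀ n k → suc k * (suc n C suc k) ≡ suc n * (n C k)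
[1+k]*[1+n]C[1+k]≡[1+n]*nCk zero zero = refl
[1+k]*[1+n]C[1+k]≡[1+n]*nCk zero (suc k) = *-zeroʳ (suc (suc k))
[1+k]*[1+n]C[1+k]≡[1+n]*nCk (suc n) zero =
  trans (*-identityˡ _) (trans (nC1≡n (suc (suc n))) (sym (*-identityʳ (suc (suc n)))))
[1+k]*[1+n]C[1+k]≡[1+n]*nCk (suc n) (suc k) = begin
  suc (suc k) * (suc (suc n) C suc (suc k))
    ≡⟨ cong (suc (suc k) *_) (nCk+nC[k+1]≡[n+1]C[k+1] (suc n) (suc k)) ⟨
  suc (suc k) * (X + Z)                          ≡⟨ *-distribˡ-+ (suc (suc k)) X Z ⟩
  (X + suc k * X) + suc (suc k) * Z
    ≡⟨ cong₂ (λ u v → (X + u) + v) ([1+k]*[1+n]C[1+k]≡[1+n]*nCk n k) ([1+k]*[1+n]C[1+k]≡[1+n]*nCk n (suc k)) ⟩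
  (X + suc n * (n C k)) + suc n * (n C suc k)    ≡⟨ +-assoc X _ _ ⟩
  X + (suc n * (n C k) + suc n * (n C suc k))    ≡⟨ cong (X +_) (*-distribˡ-+ (suc n) (n C k) _) ⟨
  X + suc n * (n C k + n C suc k)                ≡⟨ cong (λ u → X + suc n * u) (nCk+nC[k+1]≡[n+1]C[k+1] n k) ⟩
  suc (suc n) * X                                ∎
  where
  open ≡-Reasoning
  X = suc n C suc k
  Z = suc n C suc (suc k)

1≤nCk : ∀ {n k} → k ≤ n → 1 ≤ n C k
1≤nCk {n} {zero} _ = ≤-refl
1≤nCk {suc n} {suc k} (s≤s k≤n) =
  ≤-trans (1≤nCk k≤n) (≤-trans (m≤m+n _ _) (≤-reflexive (nCk+nC[k+1]≡[n+1]C[k+1] n k)))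

nCk≤[1+n]Ck : ∀ n k → n C k ≤ suc n C k
nCk≤[1+n]Ck n zero = ≤-refl
nCk≤[1+n]Ck n (suc k) = ≤-trans (m≤n+m _ _) (≤-reflexive (nCk+nC[k+1]≡[n+1]C[k+1] n k))

nC[1+k]<[1+n]C[1+k] : ∀ {n k} → k ≤ n → n C suc k < suc n C suc k
nC[1+k]<[1+n]C[1+k] {n} {k} k≤n =
  ≤-trans (+-monoˡ-≤ (n C suc k) (1≤nCk k≤n)) (≤-reflexive (nCk+nC[k+1]≡[n+1]C[k+1] n k))

C-monoˡ-≤ : ∀ k {m n} → m ≤ n → m C k ≤ n C k
C-monoˡ-≤ k {n = zero} z≤n = ≤-refl
C-monoˡ-≤ k {n = suc n} m≤1+n with m≤n⇒m<n∨m≡n m≤1+n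
... | inj₁ (s≤s m≤n) = ≤-trans (C-monoˡ-≤ k m≤n) (nCk≤[1+n]Ck n k)
... | inj₂ refl = ≤-refl

C[1+k]-mono-< : ∀ {m n k} → m < n → k < n → m C suc k < n C suc k
C[1+k]-mono-< {m} {suc n} {k} (s≤s m≤n) (s≤s k≤n) =
  ≤-trans (s≤s (C-monoˡ-≤ (suc k) m≤n)) (nC[1+k]<[1+n]C[1+k] k≤n)

cross-multiplied-bound : ∀ {D m n a b α β c c′} → 1 ≤ D → 1 ≤ m → 1 ≤ n →
  D * (a + α) ≡ m * c → D * (b + β) ≡ n * c′ → D * β ≤ n →
  (1 ≤ α × c < c′) ⊎ suc c < c′ → n * a < m * b
cross-multiplied-bound {D} {m} {n} {a} {b} {α} {β} {c} {c′} 1≤D 1≤m 1≤n D[a+α]≡mc D[b+β]≡nc′ Dβ≤n growth =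
  *-cancelˡ-< D (n * a) (m * b) (+-cancelʳ-< P (D * (n * a)) (D * (m * b)) (begin-strict
    D * (n * a) + P             <⟨ lower-gap growth ⟩
    P * c′                       ≡⟨ P*c′≡ ⟩
    D * (m * b) + m * (D * β)   ≤⟨ +-monoʳ-≤ (D * (m * b)) (*-monoʳ-≤ m Dβ≤n) ⟩
    D * (m * b) + P             ∎))
  where
  open ≤-Reasoning
  P = m * n
  distrib-scaled : ∀ D n u v → D * (n * u) + n * (D * v) ≡ n * (D * (u + v))
  distrib-scaled = solve-∀
  P*c≡ : D * (n * a) + n * (D * α) ≡ P * c
  P*c≡ = begin-equality
    D * (n * a) + n * (D * α) ≡⟨ distrib-scaled D n a α ⟩
    n * (D * (a + α))         ≡⟨ cong (n *_) D[a+α]≡mc ⟩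
    n * (m * c)               ≡⟨ *-assoc n m c ⟨
    n * m * c                 ≡⟨ cong (_* c) (*-comm n m) ⟩
    P * c                     ∎
  P*c′≡ : P * c′ ≡ D * (m * b) + m * (D * β)
  P*c′≡ = begin-equality
    P * c′                     ≡⟨ *-assoc m n c′ ⟩
    m * (n * c′)               ≡⟨ cong (m *_) D[b+β]≡nc′ ⟨
    m * (D * (b + β))         ≡⟨ distrib-scaled D m b β ⟨
    D * (m * b) + m * (D * β) ∎
  lower-gap : (1 ≤ α × c < c′) ⊎ suc c < c′ → D * (n * a) + P < P * c′
  lower-gap (inj₁ (1≤α , c<c′)) = begin-strict
    D * (n * a) + P                   <⟨ +-monoˡ-< P (m<m+n (D * (n * a)) (*-mono-≤ 1≤n (*-mono-≤ 1≤D 1≤α))) ⟩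
    D * (n * a) + n * (D * α) + P     ≡⟨ cong (_+ P) P*c≡ ⟩
    P * c + P                         ≡⟨ +-comm (P * c) P ⟩
    P + P * c                         ≡⟨ *-suc P c ⟨
    P * suc c                         ≤⟨ *-monoʳ-≤ P c<c′ ⟩
    P * c′                            ∎
  lower-gap (inj₂ 1+c<c′) = begin-strict
    D * (n * a) + P                   ≤⟨ +-monoˡ-≤ P (m≤m+n (D * (n * a)) _) ⟩
    D * (n * a) + n * (D * α) + P     ≡⟨ cong (_+ P) P*c≡ ⟩
    P * c + P                         ≡⟨ +-comm (P * c) P ⟩
    P + P * c                         ≡⟨ *-suc P c ⟨
    P * suc c                         <⟨ m<n+m (P * suc c) (*-mono-≤ 1≤m 1≤n) ⟩
    P + P * suc c                     ≡⟨ *-suc P (suc c) ⟨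
    P * suc (suc c)                   ≤⟨ *-monoʳ-≤ P 1+c<c′ ⟩
    P * c′                            ∎

binomial-ratio-bound : ∀ d {m n a b α β} → 1 ≤ d → 1 ≤ m → m < n → suc d < n →
  a + α ≡ m C suc d → b + β ≡ n C suc d → suc d * β ≤ n →
  1 ≤ α ⊎ 2 + m ≤ n → n * a < m * b
binomial-ratio-bound (suc e) {suc m} {suc (suc n)} {a} {b} {α} {β} _ 1≤m (s≤s m<1+n) (s≤s (s≤s e<n))
  a+α≡ b+β≡ Dβ≤n α-or-gap =
  cross-multiplied-bound {D = suc (suc e)} {a = a} {b} {α} {β} (s≤s z≤n) 1≤m (s≤s z≤n)
    (trans (cong (suc (suc e) *_) a+α≡) ([1+k]*[1+n]C[1+k]≡[1+n]*nCk m (suc e)))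
    (trans (cong (suc (suc e) *_) b+β≡) ([1+k]*[1+n]C[1+k]≡[1+n]*nCk (suc n) (suc e)))
    Dβ≤n (growth α-or-gap)
  where
  growth : 1 ≤ α ⊎ 2 + suc m ≤ suc (suc n) →
    (1 ≤ α × m C suc e < suc n C suc e) ⊎ suc (m C suc e) < suc n C suc e
  growth (inj₁ 1≤α) = inj₁ (1≤α , C[1+k]-mono-< m<1+n (m<n⇒m<1+n e<n))
  growth (inj₂ (s≤s (s≤s m<n))) =
    inj₂ (<-≤-trans (s≤s (C[1+k]-mono-< m<n e<n)) (nC[1+k]<[1+n]C[1+k] (<⇒≤ e<n)))

nonempty⇒1≤∣p∣ : ∀ {n} {p : Subset n} → Nonempty p → 1 ≤ ∣ p ∣
nonempty⇒1≤∣p∣ {p = p} (x , x∈p) = subst (_≤ ∣ p ∣) (∣⁅x⁆∣≡1 x) (p⊆q⇒∣p∣≤∣q∣ ⁅x⁆⊆p)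
  where
  ⁅x⁆⊆p : ⁅ x ⁆ ⊆ p
  ⁅x⁆⊆p y∈⁅x⁆ = subst (_∈ p) (sym (x∈⁅y⁆⇒x≡y x y∈⁅x⁆)) x∈p

f₀-skeleton-induced : ∀ {n m} d (J : Complex n) → NonfaceSize≥ m J → 1 < m →
  (S : Subset n) → f 0 (induced (skeleton d J) S) ≡ ∣ S ∣
f₀-skeleton-induced d J J≥m 1<m S = begin
  f₀                       ≡⟨ +-identityʳ f₀ ⟨
  f₀ + 0                   ≡⟨ cong (f₀ +_) (nonfaces-below J≥m 1<m S) ⟨
  f₀ + nonfaces 1 J S      ≡⟨ f-skeleton-induced d 0 J S z≤n ⟩
  ∣ S ∣ C 1                 ≡⟨ nC1≡n ∣ S ∣ ⟩
  ∣ S ∣                     ∎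
  where
  open ≡-Reasoning
  f₀ = f 0 (induced (skeleton d J) S)

>-from-cross : ∀ a b c e → c * b < a * e → a / b > c / e
>-from-cross a zero c zero c*0<a*0 = ⊥-elim (n≮0 (subst₂ _<_ (*-zeroʳ c) (*-zeroʳ a) c*0<a*0))
>-from-cross a zero c (suc e) _ = _
>-from-cross a (suc b) c zero c*b<a*0 = ⊥-elim (n≮0 (subst (c * suc b <_) (*-zeroʳ a) c*b<a*0))
>-from-cross a (suc b) c (suc e) c*b<a*e = c*b<a*e

lemma3p9 : (d k : ℕ) → 1 ≤ d → 1 ≤ k →
    let K = skeleton d (joinPow k (boundarySimplex (suc d))) in
    (S : Subset (suc k * suc d)) → Nonempty S → S ≢ ⊤ →
    f 0 (induced K S) / f d (induced K S) > f 0 K / f d K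
lemma3p9 (suc e) (suc k) _ _ S S-nonempty S≢⊤ =
  >-from-cross (f 0 (induced K S)) (f d (induced K S)) (f 0 K) (f d K)
    (subst₂ (λ x y → x * f d (induced K S) < y * f d K) (sym f₀K≡n) (sym (f₀ S))
      (binomial-ratio-bound d (s≤s z≤n) (nonempty⇒1≤∣p∣ S-nonempty) ∣S∣<n D<n
        (f-skeleton-induced d d J S ≤-refl) fdK Dβ≤n gap))
  where
  d = suc e
  D = suc d
  J = joinPow (suc k) (boundarySimplex D)
  K = skeleton d J
  n = suc (suc k) * D
  f₀ : ∀ S → f 0 (induced K S) ≡ ∣ S ∣
  f₀ = f₀-skeleton-induced d J (NonfaceSize≥-joinPow D (suc k)) (s≤s (s≤s z≤n))
  f₀K≡n : f 0 K ≡ n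
  f₀K≡n = trans (sym (f-induced-⊤ 0 K)) (trans (f₀ ⊤) (∣⊤∣≡n n))
  fdK : f d K + nonfaces D J ⊤ ≡ n C D
  fdK = f-skeleton d d J ≤-refl
  Dβ≤n : D * nonfaces D J ⊤ ≤ n
  Dβ≤n = ≤-trans (*-monoʳ-≤ D (nonfaces-joinPow≤ D (suc k) ⊤)) (≤-reflexive (*-comm D (suc (suc k))))
  ∣S∣<n : ∣ S ∣ < n
  ∣S∣<n = ≤∧≢⇒< (∣p∣≤n S) (S≢⊤ ∘ ∣p∣≡n⇒p≡⊤)
  D<n : D < n
  D<n = m<m+n D (s≤s z≤n)
  gap : 1 ≤ nonfaces D J S ⊎ 2 + ∣ S ∣ ≤ n
  gap = map₂ (λ deficient → ≤-trans (≤-reflexive (+-comm 2 ∣ S ∣))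
                                    (≤-trans (+-monoʳ-≤ ∣ S ∣ (s≤s (s≤s z≤n))) deficient))
             (nonface-or-deficient D (suc k) S)
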